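{- For all closed terms $P$ and $Q$: if $\mathrm{CP}+\mathrm{CP5}\vdash P=Q$ then $P=_{nr}Q$.
   Context: Fix a finite non-empty set $A$ of atomic propositions. Closed terms are built from $T$, $F$, $a\in A$ by conditional composition $P\triangleleft Q\triangleright R$. CP+CP5 consists of (CP1) $x\triangleleft T\triangleright y=x$, (CP2) $x\triangleleft F\triangleright y=y$, (CP3) $T\triangleleft x\triangleright F=x$, (CP4) $x\triangleleft(y\triangleleft z\triangleright u)\triangleright v=(x\triangleleft y\triangleright v)\triangleleft z\triangleright(x\triangleleft u\triangleright v)$, (CP5) $x\triangleleft y\triangleright(z\triangleleft u\triangleright(v\triangleleft y\triangleright w))=x\triangleleft y\triangleright(z\triangleleft u\triangleright w)$; $\vdash$ is equational derivability. A reactive valuation algebra (RVA) is a set $RV$ with elements $T_{RV},F_{RV}$ and for each $a\in A$ functions $y_a:RV\to\{T,F\}$, $\partial_a:RV\to RV$ with $y_a(T_{RV})=T$, $y_a(F_{RV})=F$, $\partial_a(T_{RV})=T_{RV}$, $\partial_a(F_{RV})=F_{RV}$. For closed $P$ and $H\in RV$: $T/H=T$, $F/H=F$, $a/H=y_a(H)$, $\partial_T(H)=\partial_F(H)=H$; $(P\triangleleft Q\triangleright R)/H=P/\partial_Q(H)$ and $\partial_{P\triangleleft Q\triangleright R}(H)=\partial_P(\partial_Q(H))$ if $Q/H=T$, and $R/\partial_Q(H)$ resp. $\partial_R(\partial_Q(H))$ if $Q/H=F$. The variety $nr$ (non-replicating valuations) is the class of RVAs satisfying $y_a(H)=y_a(\partial_P(\partial_a(H)))$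 and $\partial_a(\partial_P(\partial_a(H)))=\partial_P(\partial_a(H))$ for all $a\in A$, all $P\in A\cup\{T,F\}$ and all $H$. $P\equiv_{nr}Q$ means $P/H=Q/H$ for all RVAs in $nr$ and all $H$; $=_{nr}$ is the largest congruence (w.r.t. conditional composition) on closed terms contained in $\equiv_{nr}$. -}

module Defs where

open import Level using (suc; zero)
open import Data.Nat using (ℕ)
open import Data.Fin using (Fin)
open import Data.Bool using (Bool; true; false)
open import Data.Product using (_×_; _,_; proj₁; proj₂; Σ)
open import Relation.Binary.PropositionalEquality using (_≡_)

-- The finite non-empty set A of atomic propositions is represented as
-- Fin (ℕ.suc n) for an arbitrary n.
module _ (n : ℕ) where

  Atom : Set
  Atom = Fin (ℕ.suc n)

  infixr 5 _◁_▷_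
  data Term : Set where
    T F : Term
    atom : Atom → Term
    _◁_▷_ : Term → Term → Term → Term

  infix 4 CP5⊢_≐_
  data CP5⊢_≐_ : Term → Term → Set where
    cp1 : ∀ x y → CP5⊢ x ◁ T ▷ y ≐ x
    cp2 : ∀ x y → CP5⊢ x ◁ F ▷ y ≐ y
    cp3 : ∀ x → CP5⊢ T ◁ x ▷ F ≐ x
    cp4 : ∀ x y z u v →
          CP5⊢ x ◁ (y ◁ z ▷ u) ▷ v ≐ (x ◁ y ▷ v) ◁ z ▷ (x ◁ u ▷ v)
    cp5 : ∀ x y z u v w →
          CP5⊢ x ◁ y ▷ (z ◁ u ▷ (v ◁ y ▷ w)) ≐ x ◁ y ▷ (z ◁ u ▷ w)
    refl  : ∀ x → CP5⊢ x ≐ x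
    sym   : ∀ {x y} → CP5⊢ x ≐ y → CP5⊢ y ≐ x
    trans : ∀ {x y z} → CP5⊢ x ≐ y → CP5⊢ y ≐ z → CP5⊢ x ≐ z
    cong  : ∀ {x x' y y' z z'} → CP5⊢ x ≐ x' → CP5⊢ y ≐ y' → CP5⊢ z ≐ z' →
            CP5⊢ x ◁ y ▷ z ≐ x' ◁ y' ▷ z'

  record RVA : Set₁ where
    field
      RV  : Set
      TRV : RV
      FRV : RV
      y   : Atom → RV → Bool
      ∂   : Atom → RV → RV
      y-T : ∀ a → y a TRV ≡ true
      y-F : ∀ a → y a FRV ≡ false
      ∂-T : ∀ a → ∂ a TRV ≡ TRV
      ∂-F : ∀ a → ∂ a FRV ≡ FRV

  module _ (R : RVA) where
    open RVA R

    eval : Term → RV → Bool × RV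
    eval T H = true , H
    eval F H = false , H
    eval (atom a) H = y a H , ∂ a H
    eval (P ◁ Q ▷ R') H with eval Q H
    ... | true  , H' = eval P H'
    ... | false , H' = eval R' H'

    _/_ : Term → RV → Bool
    P / H = proj₁ (eval P H)

    ∂[_] : Term → RV → RV
    ∂[ P ] H = proj₂ (eval P H)

  data Basic : Term → Set where
    bT : Basic T
    bF : Basic F
    bA : ∀ a → Basic (atom a)

  IsNR : RVA → Set
  IsNR R = ∀ (a : Atom) (P : Term) → Basic P → ∀ (H : RVA.RV R) →
             (RVA.y R a H ≡ RVA.y R a (∂[_] R P (RVA.∂ R a H)))
           × (RVA.∂ R a (∂[_] R P (RVA.∂ R a H)) ≡ ∂[_] R P (RVA.∂ R a H))

  _≡nr_ : Term → Term → Set₁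
  P ≡nr Q = ∀ (R : RVA) → IsNR R → ∀ (H : RVA.RV R) → _/_ R P H ≡ _/_ R Q H

  record IsCongruence (∼ : Term → Term → Set₁) : Set₁ where
    field
      ∼-refl  : ∀ x → ∼ x x
      ∼-sym   : ∀ {x y} → ∼ x y → ∼ y x
      ∼-trans : ∀ {x y z} → ∼ x y → ∼ y z → ∼ x z
      ∼-cong  : ∀ {x x' y y' z z'} → ∼ x x' → ∼ y y' → ∼ z z' →
                ∼ (x ◁ y ▷ z) (x' ◁ y' ▷ z')

  -- P =_nr Q : (P , Q) lies in the largest congruence contained in ≡_nr,
  -- i.e. in the union of all congruences contained in ≡_nr (this union is
  -- itself that largest congruence).
  _=nr_ : Term → Term → Set₂
  P =nr Q = Σ (Term → Term → Set₁) λ ∼ →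
              IsCongruence ∼ × (∀ x y → ∼ x y → x ≡nr y) × ∼ P Q

-- Call P and Q equivalent if, in every non-replicating valuation algebra,
-- they yield the same reply and the same resulting valuation from every
-- valuation. This relation is a congruence contained in ≡nr, so it suffices
-- that it validates CP1–CP5; only CP5 needs the nr laws. They make the
-- valuation reached right after a query of a stable for a under any later
-- evaluation, and by induction a term t, once evaluated, replays with the
-- same reply and no effect at any later valuation. In the CP5 instance the
-- inner occurrence of y is such a replay of the outer one, answering F.
module Submission where

open import Defs
open import Data.Nat using (ℕ)
open import Data.Bool using (Bool; true; false)
open import Data.Product using (Σ; _×_; _,_; proj₁; proj₂)
open import Relation.Binary.PropositionalEquality as ≡
  using (_≡_; refl; cong₂; subst)

module _ {n : ℕ} (R : RVA n) where
  open RVA R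

  ⟦_⟧ : Term n → RV → Bool × RV
  ⟦_⟧ = eval n R

  ∂⟦_⟧ : Term n → RV → RV
  ∂⟦ t ⟧ H = proj₂ (⟦ t ⟧ H)

  ⟦◁⟧-true : ∀ P Q R′ {S S′} → ⟦ Q ⟧ S ≡ (true , S′) → ⟦ P ◁ Q ▷ R′ ⟧ S ≡ ⟦ P ⟧ S′
  ⟦◁⟧-true P Q R′ eq rewrite eq = refl

  ⟦◁⟧-false : ∀ P Q R′ {S S′} → ⟦ Q ⟧ S ≡ (false , S′) → ⟦ P ◁ Q ▷ R′ ⟧ S ≡ ⟦ R′ ⟧ S′
  ⟦◁⟧-false P Q R′ eq rewrite eq = refl

  ∂⟦◁⟧-seq : ∀ u v S → ∂⟦ v ◁ u ▷ v ⟧ S ≡ ∂⟦ v ⟧ (∂⟦ u ⟧ S)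
  ∂⟦◁⟧-seq u v S with ⟦ u ⟧ S
  ... | true  , _ = refl
  ... | false , _ = refl

  ⟦◁⟧-cong : ∀ {x x′ y y′ z z′} →
             (∀ H → ⟦ x ⟧ H ≡ ⟦ x′ ⟧ H) → (∀ H → ⟦ y ⟧ H ≡ ⟦ y′ ⟧ H) →
             (∀ H → ⟦ z ⟧ H ≡ ⟦ z′ ⟧ H) →
             ∀ H → ⟦ x ◁ y ▷ z ⟧ H ≡ ⟦ x′ ◁ y′ ▷ z′ ⟧ H
  ⟦◁⟧-cong {y′ = y′} ex ey ez H rewrite ey H with ⟦ y′ ⟧ H
  ... | true  , H′ = ex H′
  ... | false , H′ = ez H′

  ⟦cp3⟧ : ∀ x H → ⟦ T ◁ x ▷ F ⟧ H ≡ ⟦ x ⟧ H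
  ⟦cp3⟧ x H with ⟦ x ⟧ H
  ... | true  , _ = refl
  ... | false , _ = refl

  ⟦cp4⟧ : ∀ x y z u v H →
          ⟦ x ◁ (y ◁ z ▷ u) ▷ v ⟧ H ≡ ⟦ (x ◁ y ▷ v) ◁ z ▷ (x ◁ u ▷ v) ⟧ H
  ⟦cp4⟧ x y z u v H with ⟦ z ⟧ H
  ... | true , H′ with ⟦ y ⟧ H′
  ...   | true  , _ = refl
  ...   | false , _ = refl
  ⟦cp4⟧ x y z u v H | false , H′ with ⟦ u ⟧ H′
  ...   | true  , _ = refl
  ...   | false , _ = refl

  _↝_ : RV → RV → Set
  S ↝ S′ = Σ (Term n) λ u → ∂⟦ u ⟧ S ≡ S′

  ↝-trans : ∀ {S S′ S″} → S ↝ S′ → S′ ↝ S″ → S ↝ S″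
  ↝-trans {S} (u , refl) (v , refl) = v ◁ u ▷ v , ∂⟦◁⟧-seq u v S

  module _ (nr : IsNR n R) where

    data Settled (a : Atom n) (v : Bool) : RV → Set where
      settled : ∀ K → y a K ≡ v → Settled a v (∂ a K)

    settled-y : ∀ {a v S} → Settled a v S → y a S ≡ v
    settled-y {a} (settled K yv) = ≡.trans (≡.sym (proj₁ (nr a T bT K))) yv

    settled-∂ : ∀ {a v S} → Settled a v S → ∂ a S ≡ S
    settled-∂ {a} (settled K _) = proj₂ (nr a T bT K)

    settled-∂-atom : ∀ {a v S} b → Settled a v S → Settled a v (∂ b S)
    settled-∂-atom {a} {v} b (settled K yv) =
      subst (Settled a v) ∂a-fixes (settled (∂ b (∂ a K)) (≡.trans (≡.sym y-same) yv))
      where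
      y-same : y a K ≡ y a (∂ b (∂ a K))
      y-same = proj₁ (nr a (atom b) (bA b) K)
      ∂a-fixes : ∂ a (∂ b (∂ a K)) ≡ ∂ b (∂ a K)
      ∂a-fixes = proj₂ (nr a (atom b) (bA b) K)

    settled-∂⟦⟧ : ∀ {a v S} u → Settled a v S → Settled a v (∂⟦ u ⟧ S)
    settled-∂⟦⟧ T s = s
    settled-∂⟦⟧ F s = s
    settled-∂⟦⟧ (atom b) s = settled-∂-atom b s
    settled-∂⟦⟧ {S = S} (P ◁ Q ▷ R′) s with ⟦ Q ⟧ S | settled-∂⟦⟧ Q s
    ... | true  , _ | sQ = settled-∂⟦⟧ P sQ
    ... | false , _ | sQ = settled-∂⟦⟧ R′ sQ

    ⟦⟧-replay : ∀ t {H b H′ S} → ⟦ t ⟧ H ≡ (b , H′) → H′ ↝ S → ⟦ t ⟧ S ≡ (b , S)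
    ⟦⟧-replay T refl _ = refl
    ⟦⟧-replay F refl _ = refl
    ⟦⟧-replay (atom a) {H} refl (u , refl) = cong₂ _,_ (settled-y s) (settled-∂ s)
      where s = settled-∂⟦⟧ u (settled H refl)
    ⟦⟧-replay (P ◁ Q ▷ R′) {H} eq r with ⟦ Q ⟧ H in eqQ
    ... | true , _ =
      ≡.trans (⟦◁⟧-true P Q R′ (⟦⟧-replay Q eqQ (↝-trans (P , ≡.cong proj₂ eq) r)))
              (⟦⟧-replay P eq r)
    ... | false , _ =
      ≡.trans (⟦◁⟧-false P Q R′ (⟦⟧-replay Q eqQ (↝-trans (R′ , ≡.cong proj₂ eq) r)))
              (⟦⟧-replay R′ eq r)

    ⟦cp5⟧ : ∀ x y z u v w H →
            ⟦ x ◁ y ▷ (z ◁ u ▷ (v ◁ y ▷ w)) ⟧ H ≡ ⟦ x ◁ y ▷ (z ◁ u ▷ w) ⟧ H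
    ⟦cp5⟧ x y z u v w H with ⟦ y ⟧ H in eqy
    ... | true , _ = refl
    ... | false , H₁ with ⟦ u ⟧ H₁ in equ
    ...   | true  , _  = refl
    ...   | false , _  = ⟦◁⟧-false v y w (⟦⟧-replay y eqy (u , ≡.cong proj₂ equ))

module _ {n : ℕ} where

  -- Agreement of replies alone is not preserved by conditional composition;
  -- agreement of replies together with resulting valuations is.
  infix 4 _≃nr_
  record _≃nr_ (P Q : Term n) : Set₁ where
    constructor ≃nr-intro
    field ⟦⟧-≡ : ∀ (R : RVA n) → IsNR n R → ∀ H → ⟦ R ⟧ P H ≡ ⟦ R ⟧ Q H
  open _≃nr_

  ≃nr⇒≡nr : ∀ P Q → P ≃nr Q → _≡nr_ n P Q
  ≃nr⇒≡nr P Q P≃Q R nr H = ≡.cong proj₁ (⟦⟧-≡ P≃Q R nr H)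

  ≃nr-isCongruence : IsCongruence n _≃nr_
  ≃nr-isCongruence = record
    { ∼-refl  = λ _ → ≃nr-intro λ _ _ _ → refl
    ; ∼-sym   = λ p → ≃nr-intro λ R nr H → ≡.sym (⟦⟧-≡ p R nr H)
    ; ∼-trans = λ p q → ≃nr-intro λ R nr H → ≡.trans (⟦⟧-≡ p R nr H) (⟦⟧-≡ q R nr H)
    ; ∼-cong  = λ {x x′ y y′ z z′} p q r → ≃nr-intro λ R nr →
                  ⟦◁⟧-cong R {x} {x′} {y} {y′} {z} {z′} (⟦⟧-≡ p R nr) (⟦⟧-≡ q R nr) (⟦⟧-≡ r R nr)
    }
  open IsCongruence ≃nr-isCongruence

  CP5-sound : ∀ {P Q} → CP5⊢_≐_ n P Q → P ≃nr Q
  CP5-sound (cp1 x y)         = ≃nr-intro λ _ _ _ → refl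
  CP5-sound (cp2 x y)         = ≃nr-intro λ _ _ _ → refl
  CP5-sound (cp3 x)           = ≃nr-intro λ R _ → ⟦cp3⟧ R x
  CP5-sound (cp4 x y z u v)   = ≃nr-intro λ R _ → ⟦cp4⟧ R x y z u v
  CP5-sound (cp5 x y z u v w) = ≃nr-intro λ R nr → ⟦cp5⟧ R nr x y z u v w
  CP5-sound (refl x)          = ∼-refl x
  CP5-sound (sym p)           = ∼-sym (CP5-sound p)
  CP5-sound (trans p q)       = ∼-trans (CP5-sound p) (CP5-sound q)
  CP5-sound (cong p q r)      = ∼-cong (CP5-sound p) (CP5-sound q) (CP5-sound r)

mainTheorem13 : (n : ℕ) (P Q : Term n) → CP5⊢_≐_ n P Q → _=nr_ n P Q
mainTheorem13 n P Q P≐Q = _≃nr_ , ≃nr-isCongruence , ≃nr⇒≡nr , CP5-sound P≐Q
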